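{- Let $\Pi_q$ be a projective plane of order $q$ and $r\ge5$ an integer with $\binom{r}{2}\le q$. Then $T_r(\Pi_q)\ge r+1$, i.e. there is a set of points that percolates in $r$-neighbor line percolation with percolation time at least $r+1$.
   Context: A finite projective plane $\Pi_q$ of order $q\ge 2$ has point set $\mathcal P$ of size $q^2+q+1$ and $q^2+q+1$ lines; every line contains $q+1$ points, every point lies on $q+1$ lines, any two lines meet in exactly one point and any two points lie on exactly one line. $r$-neighbor line percolation: for a set $A$ of points let $A^0=A$ and for $s\ge1$ let $A^s=A^{s-1}\cup\{P: \exists \text{ line } l\ni P \text{ with } |l\cap A^{s-1}|\ge r\}$; $A$ percolates if $A^k=\mathcal P$ for some $k$, and its percolation time is the least such $k$. $T_r(\Pi_q)$ is the maximum percolation time over all percolating sets. -}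

module Defs where

open import Data.Nat using (ℕ; zero; suc; _+_; _*_; _≤_; _≤ᵇ_)
open import Data.Bool using (Bool; true; false; _∧_; _∨_; if_then_else_)
open import Data.Fin using (Fin)
import Data.Fin as F
open import Relation.Binary.PropositionalEquality using (_≡_; _≢_)

count : {n : ℕ} → (Fin n → Bool) → ℕ
count {zero}  p = 0
count {suc n} p = (if p F.zero then 1 else 0) + count (λ i → p (F.suc i))

anyFin : {n : ℕ} → (Fin n → Bool) → Bool
anyFin {zero}  p = false
anyFin {suc n} p = p F.zero ∨ anyFin (λ i → p (F.suc i))

N : ℕ → ℕ
N q = q * q + q + 1

-- A finite projective plane of order q: points and lines are both indexed
-- by Fin (q²+q+1); 'inc P l' says point P lies on line l.
record ProjectivePlane (q : ℕ) : Set where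
  field
    inc           : Fin (N q) → Fin (N q) → Bool
    line-size     : ∀ l → count (λ P → inc P l) ≡ suc q
    point-degree  : ∀ P → count (λ l → inc P l) ≡ suc q
    lines-meet    : ∀ l m → l ≢ m → count (λ P → inc P l ∧ inc P m) ≡ 1
    points-joined : ∀ P Q → P ≢ Q → count (λ l → inc P l ∧ inc Q l) ≡ 1

PointSet : ℕ → Set
PointSet q = Fin (N q) → Bool

module Percolation {q : ℕ} (Π : ProjectivePlane q) (r : ℕ) where
  open ProjectivePlane Π

  step : PointSet q → PointSet q
  step A P = A P ∨ anyFin (λ l → inc P l ∧ (r ≤ᵇ count (λ Q → inc Q l ∧ A Q)))

  iter : ℕ → PointSet q → PointSet q
  iter zero    A = A
  iter (suc s) A = step (iter s A)

  IsFull : PointSet q → Set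
  IsFull B = ∀ P → B P ≡ true

  Percolates : PointSet q → Set
  Percolates A = Σ' ℕ (λ k → IsFull (iter k A))
    where
      open import Data.Product using () renaming (Σ to Σ')

  TimeAtLeast : PointSet q → ℕ → Set
  TimeAtLeast A t = ∀ k → IsFull (iter k A) → t ≤ k

-- Take lines G 0, …, G (r - 2) in general position (possible as r C 2 ≤ q) and seed r - j
-- points on G j lying on no other G, plus an apex w on none of them. Round t + 1 then adds
-- exactly the line G t: it holds its t crossings with earlier lines and its r - t seeds, while
-- every other line holds at most r - 1 current points. After round r - 1 each line through w
-- that avoids all crossings holds r points, so these lines fill in round r; every other point
-- P then fills in round r + 1, as a line through P missing w meets them all in distinct points.
-- The seeds on G (r - 2) are where it meets the lines from w to G 0 ∩ G 1 and to G 0 ∩ G 2: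
-- this keeps every line through w below r points before round r - 1, and leaves a point of the
-- first of these lines empty after round r.

module Submission where

open import Defs
open import Data.Bool using (Bool; true; false; _∧_; _∨_; not; if_then_else_)
open import Data.Bool.Properties using (∧-conicalˡ; ∧-conicalʳ; ∧-identityʳ; ¬-not; T-≡)
open import Data.Empty using (⊥; ⊥-elim)
open import Data.Fin using (Fin; toℕ; fromℕ<) renaming (zero to fzero; suc to fsuc)
import Data.Fin.Properties as Fin
open import Data.Maybe using (Maybe; just; nothing; fromMaybe)
import Data.Maybe as Maybe
open import Data.Nat using (ℕ; zero; suc; _+_; _*_; _∸_; _≤_; _<_; z≤n; s≤s; _≤ᵇ_; _<?_; _≟_)
open import Data.Nat.Combinatorics using (_C_; nCk+nC[k+1]≡[n+1]C[k+1]; nC1≡n)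
open import Data.Nat.Properties
open import Data.Product using (Σ; _×_; _,_; proj₁; proj₂)
open import Data.Sum using (_⊎_; inj₁; inj₂)
open import Function using (_∘_)
open import Function.Bundles using (Equivalence)
open import Relation.Binary.Definitions using (tri<; tri≈; tri>)
open import Relation.Binary.PropositionalEquality
  using (_≡_; _≢_; refl; sym; trans; cong; cong₂; subst; subst₂; module ≡-Reasoning)
open import Relation.Nullary using (¬_; Dec; yes; no; does; contradiction)
open import Relation.Nullary.Decidable using (dec-true; dec-false)

true≢false : ∀ {b} → b ≡ true → b ≡ false → ⊥
true≢false refl ()

≢true⇒false : ∀ {b} → ¬ b ≡ true → b ≡ false
≢true⇒false = ¬-not

∧-intro : ∀ {a b} → a ≡ true → b ≡ true → a ∧ b ≡ true
∧-intro refl b = b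

∨-introˡ : ∀ {a} b → a ≡ true → a ∨ b ≡ true
∨-introˡ b refl = refl

∨-introʳ : ∀ a {b} → b ≡ true → a ∨ b ≡ true
∨-introʳ true  _ = refl
∨-introʳ false e = e

∨-elim : ∀ {a b} → a ∨ b ≡ true → a ≡ true ⊎ b ≡ true
∨-elim {true}  _ = inj₁ refl
∨-elim {false} e = inj₂ e

not-true⇒false : ∀ {a} → not a ≡ true → a ≡ false
not-true⇒false {false} _ = refl

not-false⇒true : ∀ {a} → a ≡ false → not a ≡ true
not-false⇒true refl = refl

Bool-⇔⇒≡ : ∀ {a b} → (a ≡ true → b ≡ true) → (b ≡ true → a ≡ true) → a ≡ b
Bool-⇔⇒≡ {true}          f _ = sym (f refl)
Bool-⇔⇒≡ {false} {true}  _ g = g refl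
Bool-⇔⇒≡ {false} {false} _ _ = refl

does-true⇒ : ∀ {A : Set} (a? : Dec A) → does a? ≡ true → A
does-true⇒ (yes a) _ = a

≤ᵇ-true⇒≤ : ∀ {m n} → (m ≤ᵇ n) ≡ true → m ≤ n
≤ᵇ-true⇒≤ {m} {n} e = ≤ᵇ⇒≤ m n (Equivalence.from T-≡ e)

≤⇒≤ᵇ-true : ∀ {m n} → m ≤ n → (m ≤ᵇ n) ≡ true
≤⇒≤ᵇ-true m≤n = Equivalence.to T-≡ (≤⇒≤ᵇ m≤n)

-- Counting

count-cong : ∀ {n} {p p′ : Fin n → Bool} → (∀ i → p i ≡ p′ i) → count p ≡ count p′
count-cong {zero}  _ = refl
count-cong {suc n} h =
  cong₂ _+_ (cong (λ b → if b then 1 else 0) (h fzero)) (count-cong (λ i → h (fsuc i)))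

count-true : ∀ n → count {n} (λ _ → true) ≡ n
count-true zero    = refl
count-true (suc n) = cong suc (count-true n)

count-remove : ∀ {n} (p : Fin n → Bool) {s : Fin n} → p s ≡ true →
               count p ≡ suc (count (λ i → p i ∧ not (does (i Fin.≟ s))))
count-remove {suc n} p {fzero} ps rewrite ps =
  cong suc (count-cong (λ i → sym (∧-identityʳ (p (fsuc i)))))
count-remove {suc n} p {fsuc s} ps with p fzero
... | true  = cong suc (count-remove (λ i → p (fsuc i)) ps)
... | false = count-remove (λ i → p (fsuc i)) ps

count-split : ∀ {n} (p u : Fin n → Bool) →
              count p ≡ count (λ i → p i ∧ u i) + count (λ i → p i ∧ not (u i))
count-split {zero}  p u = refl
count-split {suc n} p u with p fzero | u fzero
... | true  | true  = cong suc (count-split (λ i → p (fsuc i)) (λ i → u (fsuc i)))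
... | true  | false = trans (cong suc (count-split (λ i → p (fsuc i)) (λ i → u (fsuc i))))
                            (sym (+-suc _ _))
... | false | _     = count-split (λ i → p (fsuc i)) (λ i → u (fsuc i))

count-∨ : ∀ {n} (p p′ : Fin n → Bool) → count (λ i → p i ∨ p′ i) ≤ count p + count p′
count-∨ {zero}  p p′ = z≤n
count-∨ {suc n} p p′ with p fzero | p′ fzero | count-∨ (λ i → p (fsuc i)) (λ i → p′ (fsuc i))
... | true  | true  | IH = s≤s (≤-trans IH (+-monoʳ-≤ (count (λ i → p (fsuc i))) (n≤1+n _)))
... | true  | false | IH = s≤s IH
... | false | true  | IH = ≤-trans (s≤s IH) (≤-reflexive (sym (+-suc _ _)))
... | false | false | IH = IH

count-≤-injection : ∀ {n m} (p : Fin n → Bool) (t : Fin m → Bool) (R : Fin n → Fin m → Set) →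
  (∀ i → p i ≡ true → Σ (Fin m) λ s → t s ≡ true × R i s) →
  (∀ i j s → p i ≡ true → p j ≡ true → R i s → R j s → i ≡ j) →
  count p ≤ count t
count-≤-injection {zero}  p t R image unique = z≤n
count-≤-injection {suc n} {m} p t R image unique with p fzero in p0
... | false = count-≤-injection (λ i → p (fsuc i)) t (λ i → R (fsuc i))
                (λ i → image (fsuc i))
                (λ i j s pi pj ri rj → Fin.suc-injective (unique _ _ s pi pj ri rj))
... | true with image fzero p0
... | s₀ , ts₀ , r₀ = begin
  suc (count (λ i → p (fsuc i)))  ≤⟨ s≤s (count-≤-injection (λ i → p (fsuc i)) t′ (λ i → R (fsuc i))
                                                             image′ unique′) ⟩
  suc (count t′)                   ≡⟨ count-remove t ts₀ ⟨
  count t                          ∎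
  where
  open ≤-Reasoning
  t′ : Fin m → Bool
  t′ s = t s ∧ not (does (s Fin.≟ s₀))
  image′ : ∀ i → p (fsuc i) ≡ true → Σ (Fin m) λ s → t′ s ≡ true × R (fsuc i) s
  image′ i pi with image (fsuc i) pi
  ... | s , ts , ri = s , ∧-intro ts (not-false⇒true (dec-false (s Fin.≟ s₀) s≢s₀)) , ri
    where
    s≢s₀ : s ≢ s₀
    s≢s₀ refl with unique _ _ s p0 pi r₀ ri
    ... | ()
  unique′ : ∀ i j s → p (fsuc i) ≡ true → p (fsuc j) ≡ true → R (fsuc i) s → R (fsuc j) s → i ≡ j
  unique′ i j s pi pj ri rj = Fin.suc-injective (unique _ _ s pi pj ri rj)

count-≤-slots : ∀ {n} (p : Fin n → Bool) (M : ℕ) (R : Fin n → ℕ → Set) →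
  (∀ i → p i ≡ true → Σ ℕ λ s → s < M × R i s) →
  (∀ i j s → p i ≡ true → p j ≡ true → R i s → R j s → i ≡ j) →
  count p ≤ M
count-≤-slots p M R slot unique = subst (count p ≤_) (count-true M)
  (count-≤-injection p (λ _ → true) (λ i s → R i (toℕ s)) slot′
     (λ i j s pi pj → unique i j (toℕ s) pi pj))
  where
  slot′ : ∀ i → p i ≡ true → Σ (Fin M) λ s → true ≡ true × R i (toℕ s)
  slot′ i pi with slot i pi
  ... | s , s<M , ri = fromℕ< s<M , refl , subst (R i) (sym (Fin.toℕ-fromℕ< s<M)) ri

InjectiveBelow : {A : Set} → ℕ → (ℕ → A) → Set
InjectiveBelow M f = ∀ s s′ → s < M → s′ < M → f s ≡ f s′ → s ≡ s′

count-≥-injection : ∀ {n} (p : Fin n → Bool) (M : ℕ) (f : ℕ → Fin n) →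
  (∀ s → s < M → p (f s) ≡ true) → InjectiveBelow M f → M ≤ count p
count-≥-injection p M f into injective = subst (_≤ count p) (count-true M)
  (count-≤-injection (λ _ → true) p (λ s i → f (toℕ s) ≡ i)
    (λ s _ → f (toℕ s) , into _ (Fin.toℕ<n s) , refl)
    (λ s s′ i _ _ e e′ → Fin.toℕ-injective
        (injective _ _ (Fin.toℕ<n s) (Fin.toℕ<n s′) (trans e (sym e′)))))

count-≥-disjoint-injections : ∀ {n} (p : Fin n → Bool) (a b : ℕ) (f g : ℕ → Fin n) →
  (∀ s → s < a → p (f s) ≡ true) → InjectiveBelow a f →
  (∀ s → s < b → p (g s) ≡ true) → InjectiveBelow b g →
  (∀ s s′ → s < a → s′ < b → f s ≢ g s′) →
  a + b ≤ count p
count-≥-disjoint-injections {n} p a b f g pf f-inj pg g-inj disjoint =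
  count-≥-injection p (a + b) h ph h-inj
  where
  h : ℕ → Fin n
  h s = if does (s <? a) then f s else g (s ∸ a)
  h-< : ∀ {s} → s < a → h s ≡ f s
  h-< {s} s<a = cong (if_then f s else g (s ∸ a)) (dec-true (s <? a) s<a)
  h-≥ : ∀ {s} → ¬ s < a → h s ≡ g (s ∸ a)
  h-≥ {s} s≮a = cong (if_then f s else g (s ∸ a)) (dec-false (s <? a) s≮a)
  shift : ∀ {s} → s < a + b → ¬ s < a → s ∸ a < b
  shift {s} s<a+b s≮a = +-cancelˡ-< a (s ∸ a) b
    (subst (_< a + b) (sym (m+[n∸m]≡n (≮⇒≥ s≮a))) s<a+b)
  ph : ∀ s → s < a + b → p (h s) ≡ true
  ph s s<a+b with s <? a
  ... | yes s<a = subst (λ P → p P ≡ true) (sym (h-< s<a)) (pf s s<a)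
  ... | no s≮a  = subst (λ P → p P ≡ true) (sym (h-≥ s≮a)) (pg (s ∸ a) (shift s<a+b s≮a))
  h-inj : InjectiveBelow (a + b) h
  h-inj s s′ s< s′< e with s <? a | s′ <? a
  ... | yes s<a | yes s′<a = f-inj s s′ s<a s′<a (trans (sym (h-< s<a)) (trans e (h-< s′<a)))
  ... | no s≮a  | no s′≮a  = ∸-cancelʳ-≡ (≮⇒≥ s≮a) (≮⇒≥ s′≮a)
         (g-inj _ _ (shift s< s≮a) (shift s′< s′≮a) (trans (sym (h-≥ s≮a)) (trans e (h-≥ s′≮a))))
  ... | yes s<a | no s′≮a  = ⊥-elim (disjoint s (s′ ∸ a) s<a (shift s′< s′≮a)
                                (trans (sym (h-< s<a)) (trans e (h-≥ s′≮a))))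
  ... | no s≮a  | yes s′<a = ⊥-elim (disjoint s′ (s ∸ a) s′<a (shift s< s≮a)
                                (trans (sym (h-< s′<a)) (trans (sym e) (h-≥ s≮a))))

count-pos⇒∃ : ∀ {n} (p : Fin n → Bool) → 0 < count p → Σ (Fin n) λ i → p i ≡ true
count-pos⇒∃ {suc n} p pos with p fzero in p0
... | true  = fzero , p0
... | false with count-pos⇒∃ (λ i → p (fsuc i)) pos
...   | i , pi = fsuc i , pi

∃-outside : ∀ {n} (p u : Fin n → Bool) → count (λ i → p i ∧ u i) < count p →
            Σ (Fin n) λ i → p i ≡ true × u i ≡ false
∃-outside p u lt with count-pos⇒∃ (λ i → p i ∧ not (u i)) pos
  where
  open ≤-Reasoning
  pos : 0 < count (λ i → p i ∧ not (u i))
  pos = +-cancelˡ-< (count (λ i → p i ∧ u i)) 0 _ (begin-strict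
    count (λ i → p i ∧ u i) + 0                                 ≡⟨ +-identityʳ _ ⟩
    count (λ i → p i ∧ u i)                                     <⟨ lt ⟩
    count p                                                     ≡⟨ count-split p u ⟩
    count (λ i → p i ∧ u i) + count (λ i → p i ∧ not (u i))     ∎)
... | i , e = i , ∧-conicalˡ _ _ e , not-true⇒false (∧-conicalʳ _ _ e)

count≤1⇒unique : ∀ {n} (p : Fin n → Bool) {i j : Fin n} → count p ≤ 1 →
                 p i ≡ true → p j ≡ true → i ≡ j
count≤1⇒unique p {i} {j} c pi pj with i Fin.≟ j
... | yes i≡j = i≡j
... | no  i≢j = contradiction c (<⇒≱ (begin-strict
  1                ≤⟨ subst (1 ≤_) (sym (count-remove p′ pj′)) (s≤s z≤n) ⟩
  count p′         <⟨ n<1+n (count p′) ⟩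
  suc (count p′)   ≡⟨ count-remove p pi ⟨
  count p          ∎))
  where
  open ≤-Reasoning
  p′ : Fin _ → Bool
  p′ k = p k ∧ not (does (k Fin.≟ i))
  pj′ : p′ j ≡ true
  pj′ = ∧-intro pj (not-false⇒true (dec-false (j Fin.≟ i) (λ j≡i → i≢j (sym j≡i))))

anyFin-elim : ∀ {n} (p : Fin n → Bool) → anyFin p ≡ true → Σ (Fin n) λ i → p i ≡ true
anyFin-elim {suc n} p e with ∨-elim {p fzero} e
... | inj₁ p0 = fzero , p0
... | inj₂ h with anyFin-elim (λ i → p (fsuc i)) h
...   | i , pi = fsuc i , pi

anyFin-intro : ∀ {n} (p : Fin n → Bool) (i : Fin n) → p i ≡ true → anyFin p ≡ true
anyFin-intro p fzero    pi = ∨-introˡ _ pi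
anyFin-intro p (fsuc i) pi = ∨-introʳ (p fzero) (anyFin-intro (λ j → p (fsuc j)) i pi)

anyFin-cong : ∀ {n} {p p′ : Fin n → Bool} → (∀ i → p i ≡ p′ i) → anyFin p ≡ anyFin p′
anyFin-cong {zero}  _ = refl
anyFin-cong {suc n} h = cong₂ _∨_ (h fzero) (anyFin-cong (λ i → h (fsuc i)))

nth : ∀ {n} → (Fin n → Bool) → ℕ → Maybe (Fin n)
nth {zero}  p _ = nothing
nth {suc n} p k with p fzero | k
... | true  | zero   = just fzero
... | true  | suc k′ = Maybe.map fsuc (nth (λ i → p (fsuc i)) k′)
... | false | _      = Maybe.map fsuc (nth (λ i → p (fsuc i)) k)

nth-just : ∀ {n} (p : Fin n → Bool) k → k < count p → Σ (Fin n) λ i → nth p k ≡ just i × p i ≡ true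
nth-just {suc n} p k k< with p fzero in p0
nth-just {suc n} p zero    _         | true = fzero , refl , p0
nth-just {suc n} p (suc k) (s≤s k<) | true with nth-just (λ i → p (fsuc i)) k k<
... | i , e , pi rewrite e = fsuc i , refl , pi
nth-just {suc n} p k       k<        | false with nth-just (λ i → p (fsuc i)) k k<
... | i , e , pi rewrite e = fsuc i , refl , pi

private
  map-fsuc≡just : ∀ {n} (m : Maybe (Fin n)) {i} → Maybe.map fsuc m ≡ just i →
                  Σ (Fin n) λ j → i ≡ fsuc j × m ≡ just j
  map-fsuc≡just (just j) refl = j , refl , refl

  map-fsuc-injective : ∀ {n} (m m′ : Maybe (Fin n)) {i} →
                       Maybe.map fsuc m ≡ just i → Maybe.map fsuc m′ ≡ just i →
                       Σ (Fin n) λ j → m ≡ just j × m′ ≡ just j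
  map-fsuc-injective m m′ e e′ with map-fsuc≡just m e | map-fsuc≡just m′ e′
  ... | j , refl , m≡j | j′ , i≡j′ , m′≡j′ =
    j , m≡j , trans m′≡j′ (cong just (sym (Fin.suc-injective i≡j′)))

nth-injective : ∀ {n} (p : Fin n → Bool) {k k′ i} → nth p k ≡ just i → nth p k′ ≡ just i → k ≡ k′
nth-injective {suc n} p {k} {k′} e e′ with p fzero
nth-injective {suc n} p {zero}  {zero}   e    e′   | true = refl
nth-injective {suc n} p {zero}  {suc k′} refl e′   | true
  with map-fsuc≡just (nth (λ i → p (fsuc i)) k′) e′
... | _ , () , _
nth-injective {suc n} p {suc k} {zero}   e    refl | true
  with map-fsuc≡just (nth (λ i → p (fsuc i)) k) e
... | _ , () , _
nth-injective {suc n} p {suc k} {suc k′} e    e′   | true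
  with map-fsuc-injective (nth (λ i → p (fsuc i)) k) (nth (λ i → p (fsuc i)) k′) e e′
... | _ , m≡j , m′≡j = cong suc (nth-injective (λ i → p (fsuc i)) m≡j m′≡j)
nth-injective {suc n} p {k} {k′} e e′ | false
  with map-fsuc-injective (nth (λ i → p (fsuc i)) k) (nth (λ i → p (fsuc i)) k′) e e′
... | _ , m≡j , m′≡j = nth-injective (λ i → p (fsuc i)) m≡j m′≡j

-- The default d is returned only outside the range k < count p.
select : ∀ {n} → Fin n → (Fin n → Bool) → ℕ → Fin n
select d p k = fromMaybe d (nth p k)

select-∈ : ∀ {n} d (p : Fin n → Bool) {k} → k < count p → p (select d p k) ≡ true
select-∈ d p {k} k< with nth-just p k k<
... | i , e , pi rewrite e = pi

select-injective : ∀ {n} d (p : Fin n → Bool) {k k′} → k < count p → k′ < count p →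
                   select d p k ≡ select d p k′ → k ≡ k′
select-injective d p {k} {k′} k< k′< e with nth-just p k k< | nth-just p k′ k′<
... | i , ei , _ | i′ , ei′ , _ = nth-injective p ei (trans ei′ (cong just (sym i≡i′)))
  where
  i≡i′ : i ≡ i′
  i≡i′ = trans (cong (fromMaybe d) (sym ei)) (trans e (cong (fromMaybe d) ei′))

anyBelow : ℕ → (ℕ → Bool) → Bool
anyBelow zero    f = false
anyBelow (suc n) f = anyBelow n f ∨ f n

anyBelow-elim : ∀ n (f : ℕ → Bool) → anyBelow n f ≡ true → Σ ℕ λ j → j < n × f j ≡ true
anyBelow-elim (suc n) f e with ∨-elim {anyBelow n f} e
... | inj₂ fn = n , ≤-refl , fn
... | inj₁ h with anyBelow-elim n f h
...   | j , j<n , fj = j , m<n⇒m<1+n j<n , fj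

anyBelow-intro : ∀ n (f : ℕ → Bool) {j} → j < n → f j ≡ true → anyBelow n f ≡ true
anyBelow-intro (suc n) f {j} j<1+n fj with m<1+n⇒m<n∨m≡n j<1+n
... | inj₁ j<n  = ∨-introˡ _ (anyBelow-intro n f j<n fj)
... | inj₂ refl = ∨-introʳ (anyBelow n f) fj

memberBelow : ∀ {n} → ℕ → (ℕ → Fin n) → Fin n → Bool
memberBelow K F x = anyBelow K (λ s → does (x Fin.≟ F s))

memberBelow-intro : ∀ {n} K (F : ℕ → Fin n) {s} → s < K → memberBelow K F (F s) ≡ true
memberBelow-intro K F {s} s<K = anyBelow-intro K _ s<K (dec-true (F s Fin.≟ F s) refl)

memberBelow-elim : ∀ {n} K (F : ℕ → Fin n) {x} → memberBelow K F x ≡ true → Σ ℕ λ s → s < K × x ≡ F s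
memberBelow-elim K F {x} e with anyBelow-elim K _ e
... | s , s<K , h = s , s<K , does-true⇒ (x Fin.≟ F s) h

count-memberBelow : ∀ {n} K (F : ℕ → Fin n) → count (memberBelow K F) ≤ K
count-memberBelow K F = count-≤-slots (memberBelow K F) K (λ x s → x ≡ F s)
  (λ x e → memberBelow-elim K F e)
  (λ x y s _ _ x≡ y≡ → trans x≡ (sym y≡))

-- Incidence geometry

[1+n]C2 : ∀ n → suc n C 2 ≡ n C 2 + n
[1+n]C2 n = begin
  suc n C 2        ≡⟨ nCk+nC[k+1]≡[n+1]C[k+1] n 1 ⟨
  n C 1 + n C 2    ≡⟨ cong (_+ n C 2) (nC1≡n n) ⟩
  n + n C 2        ≡⟨ +-comm n (n C 2) ⟩
  n C 2 + n        ∎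
  where open ≡-Reasoning

nC2≤[1+n]C2 : ∀ n → n C 2 ≤ suc n C 2
nC2≤[1+n]C2 n = subst (n C 2 ≤_) (sym ([1+n]C2 n)) (m≤m+n (n C 2) n)

n≤[1+n]C2 : ∀ n → n ≤ suc n C 2
n≤[1+n]C2 n = subst (n ≤_) (sym ([1+n]C2 n)) (m≤n+m n (n C 2))

dual : ∀ {q} → ProjectivePlane q → ProjectivePlane q
dual Π = record
  { inc           = λ l P → inc P l
  ; line-size     = point-degree
  ; point-degree  = line-size
  ; lines-meet    = points-joined
  ; points-joined = lines-meet
  }
  where open ProjectivePlane Π

n≤nC2 : ∀ {n} → 3 ≤ n → n ≤ n C 2
n≤nC2 {n} 3≤n = subst (λ m → m ≤ m C 2) (m+[n∸m]≡n 3≤n) (3+k≤[3+k]C2 (n ∸ 3))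
  where
  3+k≤[3+k]C2 : ∀ k → 3 + k ≤ (3 + k) C 2
  3+k≤[3+k]C2 zero    = ≤-refl
  3+k≤[3+k]C2 (suc k) = begin
    1 + (3 + k)               ≤⟨ +-monoˡ-≤ (3 + k) (≤-trans (s≤s z≤n) (3+k≤[3+k]C2 k)) ⟩
    (3 + k) C 2 + (3 + k)     ≡⟨ [1+n]C2 (3 + k) ⟨
    (4 + k) C 2               ∎
    where open ≤-Reasoning

q<N : ∀ q → q < N q
q<N q = subst (q <_) (+-comm 1 (q * q + q)) (s≤s (m≤n+m q (q * q)))

module Incidence {q : ℕ} (Π : ProjectivePlane q) where
  open ProjectivePlane Π public

  Point Line : Set
  Point = Fin (N q)
  Line  = Fin (N q)

  _∈_ _∉_ : Point → Line → Set
  P ∈ l = inc P l ≡ true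
  P ∉ l = inc P l ≡ false

  ∈-∉⇒≢ : ∀ {P Q l} → P ∈ l → Q ∉ l → P ≢ Q
  ∈-∉⇒≢ P∈l Q∉l refl = true≢false P∈l Q∉l

  ∈-∉⇒≢ˡ : ∀ {P l m} → P ∈ l → P ∉ m → l ≢ m
  ∈-∉⇒≢ˡ P∈l P∉m refl = true≢false P∈l P∉m

  somePoint : Point
  somePoint = fromℕ< (≤-<-trans z≤n (q<N q))

  lines-meet-once : ∀ {l m P Q} → l ≢ m → P ∈ l → P ∈ m → Q ∈ l → Q ∈ m → P ≡ Q
  lines-meet-once {l} {m} l≢m P∈l P∈m Q∈l Q∈m =
    count≤1⇒unique (λ X → inc X l ∧ inc X m) (≤-reflexive (lines-meet l m l≢m))
      (∧-intro P∈l P∈m) (∧-intro Q∈l Q∈m)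

  meet : Line → Line → Point
  meet l m = select somePoint (λ P → inc P l ∧ inc P m) 0

  meet-∈ : ∀ {l m} → l ≢ m → meet l m ∈ l × meet l m ∈ m
  meet-∈ {l} {m} l≢m = ∧-conicalˡ _ _ on-both , ∧-conicalʳ _ _ on-both
    where
    on-both : inc (meet l m) l ∧ inc (meet l m) m ≡ true
    on-both = select-∈ somePoint (λ P → inc P l ∧ inc P m)
                (≤-reflexive (sym (lines-meet l m l≢m)))

  covered : (Line → Bool) → Point → Bool
  covered bad P = anyFin (λ l → bad l ∧ inc P l)

  covered-intro : ∀ (bad : Line → Bool) {P l} → bad l ≡ true → P ∈ l → covered bad P ≡ true
  covered-intro bad {P} {l} l-bad P∈l = anyFin-intro (λ m → bad m ∧ inc P m) l (∧-intro l-bad P∈l)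

  count-covered-on-line : ∀ (bad : Line → Bool) {ℓ} → bad ℓ ≡ false →
    count (λ P → inc P ℓ ∧ covered bad P) ≤ count bad
  count-covered-on-line bad {ℓ} ℓ-good =
    count-≤-injection _ bad (λ P l → P ∈ l × bad l ≡ true) image unique
    where
    image : ∀ P → inc P ℓ ∧ covered bad P ≡ true →
            Σ Line λ l → bad l ≡ true × (P ∈ l × bad l ≡ true)
    image P e with anyFin-elim _ (∧-conicalʳ _ _ e)
    ... | l , h = l , ∧-conicalˡ _ _ h , ∧-conicalʳ _ _ h , ∧-conicalˡ _ _ h
    unique : ∀ P Q l → inc P ℓ ∧ covered bad P ≡ true → inc Q ℓ ∧ covered bad Q ≡ true →
             P ∈ l × bad l ≡ true → Q ∈ l × bad l ≡ true → P ≡ Q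
    unique P Q l eP eQ (P∈l , l-bad) (Q∈l , _) =
      lines-meet-once (λ { refl → true≢false l-bad ℓ-good })
        (∧-conicalˡ _ _ eP) P∈l (∧-conicalˡ _ _ eQ) Q∈l

  point-on-line-off-lines : ∀ (bad : Line → Bool) {ℓ} → bad ℓ ≡ false → count bad ≤ q →
    Σ Point λ P → P ∈ ℓ × (∀ l → bad l ≡ true → P ∉ l)
  point-on-line-off-lines bad {ℓ} ℓ-good few with ∃-outside (λ P → inc P ℓ) (covered bad) fewer
    where
    fewer : count (λ P → inc P ℓ ∧ covered bad P) < count (λ P → inc P ℓ)
    fewer = ≤-<-trans (≤-trans (count-covered-on-line bad ℓ-good) few)
                      (subst (q <_) (sym (line-size ℓ)) ≤-refl)
  ... | P , P∈ℓ , uncovered = P , P∈ℓ , λ l l-bad →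
    ≢true⇒false λ P∈l → true≢false (covered-intro bad l-bad P∈l) uncovered

module Plane {q : ℕ} (Π : ProjectivePlane q) where
  open Incidence Π public
  open Incidence (dual Π) public using () renaming
    ( lines-meet-once         to points-joined-once
    ; meet                    to join
    ; meet-∈                  to join-∋
    ; covered                 to meets
    ; covered-intro           to meets-intro
    ; count-covered-on-line   to count-meeting-through-point
    ; point-on-line-off-lines to line-through-avoiding
    )

  point-off-lines : ∀ (bad : Line → Bool) → count bad ≤ q →
                    Σ Point λ P → ∀ l → bad l ≡ true → P ∉ l
  point-off-lines bad few with ∃-outside (λ _ → true) bad fewer
    where
    fewer : count (λ l → true ∧ bad l) < count {N q} (λ _ → true)
    fewer = subst (count bad <_) (sym (count-true (N q))) (≤-<-trans few (q<N q))
  ... | ℓ , _ , ℓ-good with point-on-line-off-lines bad ℓ-good few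
  ...   | P , _ , P-off = P , P-off

  Distinct : ℕ → (ℕ → Line) → Set
  Distinct n G = ∀ {j k} → j < k → k < n → G j ≢ G k

  NoThreeConcurrent : ℕ → (ℕ → Line) → Set
  NoThreeConcurrent n G = ∀ {i j k P} → i < j → j < k → k < n → P ∈ G i → P ∈ G j → P ∈ G k → ⊥

  crossing : ℕ → (ℕ → Line) → Point → Bool
  crossing n G P = anyBelow n (λ k → anyBelow k (λ j → inc P (G j) ∧ inc P (G k)))

  crossing-intro : ∀ {n} G {j k P} → j < k → k < n → P ∈ G j → P ∈ G k → crossing n G P ≡ true
  crossing-intro {n} G j<k k<n P∈j P∈k =
    anyBelow-intro n _ k<n (anyBelow-intro _ _ j<k (∧-intro P∈j P∈k))

  crossing-intro-≢ : ∀ {n} G {j k P} → j < n → k < n → j ≢ k → P ∈ G j → P ∈ G k →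
                     crossing n G P ≡ true
  crossing-intro-≢ G {j} {k} j<n k<n j≢k P∈j P∈k with <-cmp j k
  ... | tri< j<k _ _ = crossing-intro G j<k k<n P∈j P∈k
  ... | tri≈ _ j≡k _ = contradiction j≡k j≢k
  ... | tri> _ _ k<j = crossing-intro G k<j j<n P∈k P∈j

  crossing-elim : ∀ {n} G {P} → crossing n G P ≡ true → Σ ℕ λ j → j < n × P ∈ G j
  crossing-elim {n} G e with anyBelow-elim n _ e
  ... | k , k<n , h with anyBelow-elim k _ h
  ...   | j , j<k , h′ = j , <-trans j<k k<n , ∧-conicalˡ _ _ h′

  count-crossing : ∀ n G → Distinct n G → count (crossing n G) ≤ n C 2
  count-crossing zero    G _ = count-≤-slots (crossing zero G) 0 (λ _ _ → ⊥) (λ _ ()) (λ _ _ _ ())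
  count-crossing (suc n) G distinct = begin
    count (crossing (suc n) G)                   ≤⟨ count-∨ (crossing n G) on-last ⟩
    count (crossing n G) + count on-last         ≤⟨ +-mono-≤ (count-crossing n G distinct-below) count-on-last ⟩
    n C 2 + n                                    ≡⟨ [1+n]C2 n ⟨
    suc n C 2                                    ∎
    where
    open ≤-Reasoning
    distinct-below : Distinct n G
    distinct-below j<k k<n = distinct j<k (m<n⇒m<1+n k<n)
    on-last : Point → Bool
    on-last P = anyBelow n (λ j → inc P (G j) ∧ inc P (G n))
    count-on-last : count on-last ≤ n
    count-on-last = count-≤-slots on-last n (λ P j → j < n × P ∈ G j × P ∈ G n)
      (λ P e → let (j , j<n , h) = anyBelow-elim n _ e in
                j , j<n , j<n , ∧-conicalˡ _ _ h , ∧-conicalʳ _ _ h)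
      (λ P Q j _ _ (j<n , P∈j , P∈n) (_ , Q∈j , Q∈n) →
         lines-meet-once (distinct j<n ≤-refl) P∈j P∈n Q∈j Q∈n)

  off-lines⇒¬crossing : ∀ {n} G {X} → (∀ {j} → j < n → X ∉ G j) → crossing n G X ≡ false
  off-lines⇒¬crossing G X-off = ≢true⇒false λ e →
    let (j , j<n , X∈j) = crossing-elim G e in true≢false X∈j (X-off j<n)

  extend : ℕ → (ℕ → Line) → Line → ℕ → Line
  extend n G ℓ j = if does (j ≟ n) then ℓ else G j

  extend-< : ∀ {n G ℓ j} → j < n → extend n G ℓ j ≡ G j
  extend-< {n} {G} {ℓ} {j} j<n = cong (if_then ℓ else G j) (dec-false (j ≟ n) (<⇒≢ j<n))

  extend-≡ : ∀ {n G ℓ} → extend n G ℓ n ≡ ℓ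
  extend-≡ {n} {G} {ℓ} = cong (if_then ℓ else G n) (dec-true (n ≟ n) refl)

  extend-general-position : ∀ {n G ℓ X} → Distinct n G → NoThreeConcurrent n G →
    (∀ {j} → j < n → X ∉ G j) → X ∈ ℓ → (∀ P → crossing n G P ≡ true → P ∉ ℓ) →
    Distinct (suc n) (extend n G ℓ) × NoThreeConcurrent (suc n) (extend n G ℓ)
  extend-general-position {n} {G} {ℓ} {X} distinct noThree X∉G X∈ℓ ℓ-avoids = distinct′ , noThree′
    where
    G′ : ℕ → Line
    G′ = extend n G ℓ
    G′-< : ∀ {j} → j < n → G′ j ≡ G j
    G′-< = extend-< {n} {G} {ℓ}
    G′-n : G′ n ≡ ℓ
    G′-n = extend-≡ {n} {G} {ℓ}
    old : ∀ {P j} → j < n → P ∈ G′ j → P ∈ G j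
    old j<n = subst (_ ∈_) (G′-< j<n)
    distinct′ : Distinct (suc n) G′
    distinct′ {j} {k} j<k k<1+n Gj≡Gk with m<1+n⇒m<n∨m≡n k<1+n
    ... | inj₁ k<n  = distinct j<k k<n (trans (sym (G′-< (<-trans j<k k<n))) (trans Gj≡Gk (G′-< k<n)))
    ... | inj₂ refl = true≢false (old j<k (subst (X ∈_) (sym Gj≡Gk) (subst (X ∈_) (sym G′-n) X∈ℓ)))
                        (X∉G j<k)
    noThree′ : NoThreeConcurrent (suc n) G′
    noThree′ {i} {j} {k} i<j j<k k<1+n P∈i P∈j P∈k with m<1+n⇒m<n∨m≡n k<1+n
    ... | inj₁ k<n  = noThree i<j j<k k<n (old (<-trans i<j (<-trans j<k k<n)) P∈i)
                        (old (<-trans j<k k<n) P∈j) (old k<n P∈k)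
    ... | inj₂ refl = true≢false (subst (_ ∈_) G′-n P∈k)
                        (ℓ-avoids _ (crossing-intro G i<j j<k (old (<-trans i<j j<k) P∈i) (old j<k P∈j)))

  -- Add lines one at a time: a point X off the previous lines, then a line through X
  -- missing all their crossings.
  general-position : ∀ n → n C 2 ≤ q → Σ (ℕ → Line) λ G → Distinct n G × NoThreeConcurrent n G
  general-position zero    _     = (λ _ → somePoint) , (λ _ ()) , (λ _ _ ())
  general-position (suc n) C2≤q
    with general-position n (≤-trans (nC2≤[1+n]C2 n) C2≤q)
  ... | G , distinct , noThree
    with point-off-lines (memberBelow n G) (≤-trans (count-memberBelow n G) (≤-trans (n≤[1+n]C2 n) C2≤q))
  ... | X , X-off
    with line-through-avoiding (crossing n G) (off-lines⇒¬crossing G (X-off _ ∘ memberBelow-intro n G))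
           (≤-trans (count-crossing n G distinct) (≤-trans (nC2≤[1+n]C2 n) C2≤q))
  ... | ℓ , X∈ℓ , ℓ-avoids =
    extend n G ℓ , extend-general-position distinct noThree (X-off _ ∘ memberBelow-intro n G) X∈ℓ ℓ-avoids

-- Line percolation

module PercolationFacts {q : ℕ} (Π : ProjectivePlane q) (r : ℕ) where
  open Incidence Π
  open Percolation Π r public

  ∣_∩_∣ : Line → PointSet q → ℕ
  ∣ l ∩ B ∣ = count (λ Q → inc Q l ∧ B Q)

  ∣∩∣-cong : ∀ l {B B′ : PointSet q} → (∀ P → B P ≡ B′ P) → ∣ l ∩ B ∣ ≡ ∣ l ∩ B′ ∣
  ∣∩∣-cong l h = count-cong (λ Q → cong (inc Q l ∧_) (h Q))

  step-cong : ∀ {B B′ : PointSet q} → (∀ P → B P ≡ B′ P) → ∀ P → step B P ≡ step B′ P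
  step-cong h P = cong₂ _∨_ (h P) (anyFin-cong λ l → cong (λ n → inc P l ∧ (r ≤ᵇ n)) (∣∩∣-cong l h))

  step-extensive : ∀ {B : PointSet q} {P} → B P ≡ true → step B P ≡ true
  step-extensive = ∨-introˡ _

  step-fires : ∀ {B : PointSet q} {P l} → P ∈ l → r ≤ ∣ l ∩ B ∣ → step B P ≡ true
  step-fires {B} {P} {l} P∈l rich = ∨-introʳ (B P) (anyFin-intro _ l (∧-intro P∈l (≤⇒≤ᵇ-true rich)))

  step-elim : ∀ {B : PointSet q} {P} → step B P ≡ true →
              B P ≡ true ⊎ Σ Line λ l → P ∈ l × r ≤ ∣ l ∩ B ∣
  step-elim {B} {P} e with ∨-elim {B P} e
  ... | inj₁ old = inj₁ old
  ... | inj₂ h with anyFin-elim _ h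
  ...   | l , fired = inj₂ (l , ∧-conicalˡ _ _ fired , ≤ᵇ-true⇒≤ (∧-conicalʳ _ _ fired))

  iter-mono : ∀ {k m} (A : PointSet q) {P} → k ≤ m → iter k A P ≡ true → iter m A P ≡ true
  iter-mono {m = zero}  A z≤n e = e
  iter-mono {m = suc m} A k≤1+m e with m≤n⇒m<n∨m≡n k≤1+m
  ... | inj₁ k<1+m = step-extensive (iter-mono A (≤-pred k<1+m) e)
  ... | inj₂ refl  = e

-- The slow percolating set

data Side : ℕ → Set where
  side₁ : Side 1
  side₂ : Side 2

module Construction {q : ℕ} (Π : ProjectivePlane q) (last : ℕ) (3≤last : 3 ≤ last)
                    (rC2≤q : suc (suc last) C 2 ≤ q) (G : ℕ → Fin (N q))
                    (distinct : Plane.Distinct Π (suc last) G)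
                    (noThree : Plane.NoThreeConcurrent Π (suc last) G) where
  open Plane Π

  L r : ℕ
  L = suc last
  r = suc L

  open PercolationFacts Π r

  LC2+L≤q : L C 2 + L ≤ q
  LC2+L≤q = subst (_≤ q) ([1+n]C2 L) rC2≤q

  L+L≤q : L + L ≤ q
  L+L≤q = ≤-trans (+-monoˡ-≤ L (n≤nC2 (≤-trans 3≤last (n≤1+n last)))) LC2+L≤q

  L<q : L < q
  L<q = <-≤-trans (m<m+n L (s≤s z≤n)) L+L≤q

  last<L : last < L
  last<L = ≤-refl

  side-pos : ∀ {i} → Side i → 0 < i
  side-pos side₁ = s≤s z≤n
  side-pos side₂ = s≤s z≤n

  side-<last : ∀ {i} → Side i → i < last
  side-<last side₁ = ≤-trans (s≤s (s≤s z≤n)) 3≤last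
  side-<last side₂ = 3≤last

  side-<L : ∀ {i} → Side i → i < L
  side-<L s = <-trans (side-<last s) last<L

  G-injective : ∀ {j k} → j < L → k < L → j ≢ k → G j ≢ G k
  G-injective {j} {k} j<L k<L j≢k with <-cmp j k
  ... | tri< j<k _ _ = distinct j<k k<L
  ... | tri≈ _ j≡k _ = contradiction j≡k j≢k
  ... | tri> _ _ k<j = λ e → distinct k<j j<L (sym e)

  third-line-avoids : ∀ {i j k P} → i < k → j < k → k < L → i ≢ j → P ∈ G i → P ∈ G j → P ∉ G k
  third-line-avoids {i} {j} {k} {P} i<k j<k k<L i≢j P∈i P∈j = ≢true⇒false concurrent
    where
    concurrent : P ∈ G k → ⊥
    concurrent P∈k with <-cmp i j
    ... | tri< i<j _ _ = noThree i<j j<k k<L P∈i P∈j P∈k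
    ... | tri≈ _ i≡j _ = i≢j i≡j
    ... | tri> _ _ j<i = noThree j<i i<k k<L P∈j P∈i P∈k

  NotG : Line → Set
  NotG l = ∀ {j} → j < L → l ≢ G j

  corner : ℕ → Point
  corner i = meet (G 0) (G i)

  corner-∈ : ∀ {i} → Side i → corner i ∈ G 0 × corner i ∈ G i
  corner-∈ s = meet-∈ (G-injective (s≤s z≤n) (side-<L s) (λ 0≡i → <⇒≢ (side-pos s) 0≡i))

  corner-∉last : ∀ {i} → Side i → corner i ∉ G last
  corner-∉last s = third-line-avoids (≤-trans (side-pos s) (<⇒≤ (side-<last s))) (side-<last s) last<L
                     (<⇒≢ (side-pos s)) (proj₁ (corner-∈ s)) (proj₂ (corner-∈ s))

  corner₁≢corner₂ : corner 1 ≢ corner 2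
  corner₁≢corner₂ e = true≢false (subst (_∈ G 2) (sym e) (proj₂ (corner-∈ side₂)))
    (third-line-avoids (s≤s z≤n) (s≤s (s≤s z≤n)) (side-<L side₂) (λ ())
      (proj₁ (corner-∈ side₁)) (proj₂ (corner-∈ side₁)))

  -- The apex w is chosen off these lines, which keeps each foot off the lines G j with j ≢ last.
  J : ℕ → ℕ → Line
  J i j = join (corner i) (meet (G last) (G j))

  someJ : Line → Bool
  someJ l = memberBelow last (J 1) l ∨ memberBelow last (J 2) l

  apexBad : Line → Bool
  apexBad l = memberBelow L G l ∨ someJ l

  count-apexBad : count apexBad ≤ q
  count-apexBad = begin
    count apexBad                           ≤⟨ count-∨ (memberBelow L G) someJ ⟩
    count (memberBelow L G) + count someJ   ≤⟨ +-mono-≤ (count-memberBelow L G) count-someJ ⟩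
    L + (last + last)                       ≤⟨ +-monoʳ-≤ L (+-monoˡ-≤ last (n≤nC2 3≤last)) ⟩
    L + (last C 2 + last)                   ≡⟨ cong (L +_) ([1+n]C2 last) ⟨
    L + L C 2                               ≡⟨ +-comm L (L C 2) ⟩
    L C 2 + L                               ≤⟨ LC2+L≤q ⟩
    q                                       ∎
    where
    open ≤-Reasoning
    count-someJ : count someJ ≤ last + last
    count-someJ = ≤-trans (count-∨ (memberBelow last (J 1)) (memberBelow last (J 2)))
                          (+-mono-≤ (count-memberBelow last (J 1)) (count-memberBelow last (J 2)))

  module WithApex (w : Point) (w-off : ∀ l → apexBad l ≡ true → w ∉ l) where

    w∉G : ∀ {j} → j < L → w ∉ G j
    w∉G j<L = w-off _ (∨-introˡ _ (memberBelow-intro L G j<L))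

    w∉J : ∀ {i j} → Side i → j < last → w ∉ J i j
    w∉J {j = j} side₁ j<last =
      w-off _ (∨-introʳ (memberBelow L G (J 1 j)) (∨-introˡ _ (memberBelow-intro last (J 1) j<last)))
    w∉J {j = j} side₂ j<last =
      w-off _ (∨-introʳ (memberBelow L G (J 2 j))
                 (∨-introʳ (memberBelow last (J 1) (J 2 j)) (memberBelow-intro last (J 2) j<last)))

    ∋w⇒NotG : ∀ {l} → w ∈ l → NotG l
    ∋w⇒NotG w∈l j<L = ∈-∉⇒≢ˡ w∈l (w∉G j<L)

    w≢G-point : ∀ {P j} → j < L → P ∈ G j → w ≢ P
    w≢G-point j<L P∈j w≡P = ∈-∉⇒≢ P∈j (w∉G j<L) (sym w≡P)

    spoke : ℕ → Line
    spoke i = join w (corner i)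

    spoke-∋ : ∀ {i} → Side i → w ∈ spoke i × corner i ∈ spoke i
    spoke-∋ s = join-∋ (w≢G-point (s≤s z≤n) (proj₁ (corner-∈ s)))

    foot : ℕ → Point
    foot i = meet (spoke i) (G last)

    foot-∈ : ∀ {i} → Side i → foot i ∈ spoke i × foot i ∈ G last
    foot-∈ s = meet-∈ (∋w⇒NotG (proj₁ (spoke-∋ s)) last<L)

    w≢foot : ∀ {i} → Side i → w ≢ foot i
    w≢foot s = w≢G-point last<L (proj₂ (foot-∈ s))

    spoke-unique : ∀ {i m} → Side i → w ∈ m → foot i ∈ m → spoke i ≡ m
    spoke-unique s w∈m foot∈m =
      points-joined-once (w≢foot s) (proj₁ (spoke-∋ s)) (proj₁ (foot-∈ s)) w∈m foot∈m

    -- If foot i were on G j, the spoke would be J i j, which misses w.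
    foot-∉ : ∀ {i j} → Side i → j < L → j ≢ last → foot i ∉ G j
    foot-∉ {i} {j} s j<L j≢last = ≢true⇒false λ foot∈j →
      true≢false (subst (w ∈_) (spoke≡J foot∈j) (proj₁ (spoke-∋ s))) (w∉J s j<last)
      where
      j<last : j < last
      j<last with m<1+n⇒m<n∨m≡n j<L
      ... | inj₁ j<last = j<last
      ... | inj₂ j≡last = contradiction j≡last j≢last
      Q∈ : meet (G last) (G j) ∈ G last × meet (G last) (G j) ∈ G j
      Q∈ = meet-∈ (G-injective last<L j<L (λ last≡j → j≢last (sym last≡j)))
      spoke≡J : foot i ∈ G j → spoke i ≡ J i j
      spoke≡J foot∈j =
        points-joined-once corner≢Q (proj₂ (spoke-∋ s)) (subst (_∈ spoke i) foot≡Q (proj₁ (foot-∈ s)))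
          (proj₁ (join-∋ corner≢Q)) (proj₂ (join-∋ corner≢Q))
        where
        foot≡Q : foot i ≡ meet (G last) (G j)
        foot≡Q = lines-meet-once (G-injective last<L j<L (λ last≡j → j≢last (sym last≡j)))
                   (proj₂ (foot-∈ s)) foot∈j (proj₁ Q∈) (proj₂ Q∈)
        corner≢Q : corner i ≢ meet (G last) (G j)
        corner≢Q c≡Q = ∈-∉⇒≢ (proj₁ Q∈) (corner-∉last s) (sym c≡Q)

    corner-∈-through-foot : ∀ {i m} → Side i → w ∈ m → foot i ∈ m → corner i ∈ m
    corner-∈-through-foot s w∈m foot∈m = subst (corner _ ∈_) (spoke-unique s w∈m foot∈m) (proj₂ (spoke-∋ s))

    foot₁≢foot₂ : foot 1 ≢ foot 2
    foot₁≢foot₂ e = true≢false (subst (w ∈_) spoke₁≡G₀ (proj₁ (spoke-∋ side₁))) (w∉G (s≤s z≤n))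
      where
      spoke₁∋corner₂ : corner 2 ∈ spoke 1
      spoke₁∋corner₂ = subst (corner 2 ∈_) (sym (spoke-unique side₁ (proj₁ (spoke-∋ side₂))
                                                   (subst (_∈ spoke 2) (sym e) (proj₁ (foot-∈ side₂)))))
                         (proj₂ (spoke-∋ side₂))
      spoke₁≡G₀ : spoke 1 ≡ G 0
      spoke₁≡G₀ = points-joined-once corner₁≢corner₂ (proj₂ (spoke-∋ side₁)) spoke₁∋corner₂
                    (proj₁ (corner-∈ side₁)) (proj₁ (corner-∈ side₂))

    -- The r - j seeds on G j lie on no other line of the family; on G last they are the two feet.
    size : ℕ → ℕ
    size j = r ∸ j

    size-last : size last ≡ 2
    size-last = m+n∸n≡m 2 last

    onOther : ℕ → Point → Bool
    onOther j P = anyBelow L (λ i → not (does (i ≟ j)) ∧ inc P (G i))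

    onlyOn : ℕ → Point → Bool
    onlyOn j P = inc P (G j) ∧ not (onOther j P)

    count-onOther : ∀ {j} → j < L → count (λ P → inc P (G j) ∧ onOther j P) ≤ L
    count-onOther {j} j<L = count-≤-slots _ L (λ P i → i < L × i ≢ j × P ∈ G i) slot unique
      where
      slot : ∀ P → inc P (G j) ∧ onOther j P ≡ true → Σ ℕ λ i → i < L × (i < L × i ≢ j × P ∈ G i)
      slot P e with anyBelow-elim L _ (∧-conicalʳ _ _ e)
      ... | i , i<L , h = i , i<L , i<L , i≢j , ∧-conicalʳ _ _ h
        where
        i≢j : i ≢ j
        i≢j i≡j = true≢false (dec-true (i ≟ j) i≡j) (not-true⇒false (∧-conicalˡ _ _ h))
      unique : ∀ P Q i → inc P (G j) ∧ onOther j P ≡ true → inc Q (G j) ∧ onOther j Q ≡ true →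
               i < L × i ≢ j × P ∈ G i → i < L × i ≢ j × Q ∈ G i → P ≡ Q
      unique P Q i eP eQ (i<L , i≢j , P∈i) (_ , _ , Q∈i) =
        lines-meet-once (G-injective j<L i<L (λ j≡i → i≢j (sym j≡i)))
          (∧-conicalˡ _ _ eP) P∈i (∧-conicalˡ _ _ eQ) Q∈i

    L<count-onlyOn : ∀ {j} → j < L → L < count (onlyOn j)
    L<count-onlyOn {j} j<L = +-cancelˡ-< (count (λ P → inc P (G j) ∧ onOther j P)) L _ (begin-strict
      count (λ P → inc P (G j) ∧ onOther j P) + L                 ≤⟨ +-monoˡ-≤ L (count-onOther j<L) ⟩
      L + L                                                       <⟨ s≤s L+L≤q ⟩
      suc q                                                       ≡⟨ line-size (G j) ⟨
      count (λ P → inc P (G j))                                   ≡⟨ count-split (λ P → inc P (G j)) (onOther j) ⟩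
      count (λ P → inc P (G j) ∧ onOther j P) + count (onlyOn j)  ∎)
      where open ≤-Reasoning

    <size⇒<count-onlyOn : ∀ {j k} → j < L → k < size j → k < count (onlyOn j)
    <size⇒<count-onlyOn {j} j<L k<size = <-≤-trans k<size (≤-trans (m∸n≤m r j) (L<count-onlyOn j<L))

    feet : ℕ → Point
    feet zero    = foot 1
    feet (suc _) = foot 2

    seedPoint : ℕ → ℕ → Point
    seedPoint j k = if does (j ≟ last) then feet k else select somePoint (onlyOn j) k

    seedPoint-last : ∀ {k} → seedPoint last k ≡ feet k
    seedPoint-last {k} =
      cong (if_then feet k else select somePoint (onlyOn last) k) (dec-true (last ≟ last) refl)

    seedPoint-other : ∀ {j k} → j ≢ last → seedPoint j k ≡ select somePoint (onlyOn j) k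
    seedPoint-other {j} {k} j≢last =
      cong (if_then feet k else select somePoint (onlyOn j) k) (dec-false (j ≟ last) j≢last)

    seedPoint-onlyOn : ∀ {j k} → j < L → j ≢ last → k < size j → onlyOn j (seedPoint j k) ≡ true
    seedPoint-onlyOn j<L j≢last k<size = subst (λ P → onlyOn _ P ≡ true) (sym (seedPoint-other j≢last))
      (select-∈ somePoint (onlyOn _) (<size⇒<count-onlyOn j<L k<size))

    seedPoint-∈ : ∀ {j k} → j < L → k < size j → seedPoint j k ∈ G j
    seedPoint-∈ {j} {k} j<L k<size with j ≟ last
    ... | no j≢last = ∧-conicalˡ _ _ (seedPoint-onlyOn j<L j≢last k<size)
    ... | yes refl  = subst (_∈ G last) (sym seedPoint-last) (feet-∈ k)
      where
      feet-∈ : ∀ k → feet k ∈ G last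
      feet-∈ zero    = proj₂ (foot-∈ side₁)
      feet-∈ (suc _) = proj₂ (foot-∈ side₂)

    seedPoint-∉ : ∀ {i j k} → j < L → k < size j → i < L → i ≢ j → seedPoint j k ∉ G i
    seedPoint-∉ {i} {j} {k} j<L k<size i<L i≢j with j ≟ last
    ... | no j≢last = ≢true⇒false λ P∈i →
            true≢false (anyBelow-intro L _ i<L (∧-intro (not-false⇒true (dec-false (i ≟ j) i≢j)) P∈i))
                       (not-true⇒false (∧-conicalʳ _ _ (seedPoint-onlyOn j<L j≢last k<size)))
    ... | yes refl  = subst (_∉ G i) (sym seedPoint-last) (feet-∉ k)
      where
      feet-∉ : ∀ k → feet k ∉ G i
      feet-∉ zero    = foot-∉ side₁ i<L i≢j
      feet-∉ (suc _) = foot-∉ side₂ i<L i≢j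

    seedPoint-injective : ∀ {j k k′} → j < L → k < size j → k′ < size j →
                          seedPoint j k ≡ seedPoint j k′ → k ≡ k′
    seedPoint-injective {j} {k} {k′} j<L k<size k′<size e with j ≟ last
    ... | no j≢last = select-injective somePoint (onlyOn j) (<size⇒<count-onlyOn j<L k<size)
                        (<size⇒<count-onlyOn j<L k′<size)
                        (trans (sym (seedPoint-other j≢last)) (trans e (seedPoint-other j≢last)))
    ... | yes refl  = feet-injective k k′ (subst (k <_) size-last k<size) (subst (k′ <_) size-last k′<size)
                        (trans (sym seedPoint-last) (trans e seedPoint-last))
      where
      feet-injective : ∀ k k′ → k < 2 → k′ < 2 → feet k ≡ feet k′ → k ≡ k′
      feet-injective zero          zero          _ _ _ = refl
      feet-injective zero          (suc zero)    _ _ e = contradiction e foot₁≢foot₂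
      feet-injective (suc zero)    zero          _ _ e = contradiction (sym e) foot₁≢foot₂
      feet-injective (suc zero)    (suc zero)    _ _ _ = refl
      feet-injective (suc (suc _)) _             (s≤s (s≤s ())) _ _
      feet-injective _             (suc (suc _)) _ (s≤s (s≤s ())) _

    seed : PointSet q
    seed P = anyBelow L (λ j → anyBelow (size j) (λ k → does (P Fin.≟ seedPoint j k))) ∨ does (P Fin.≟ w)

    onFirst : ℕ → PointSet q
    onFirst t P = anyBelow t (λ j → inc P (G j))

    -- the set reached after t rounds: the seeds together with the lines G 0, …, G (t - 1)
    stage : ℕ → PointSet q
    stage t P = onFirst t P ∨ seed P

    data InStage (t : ℕ) (P : Point) : Set where
      on-G   : ∀ {j} → j < t → P ∈ G j → InStage t P
      seeded : ∀ {j k} → j < L → k < size j → P ≡ seedPoint j k → InStage t P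
      apex   : P ≡ w → InStage t P

    stage-view : ∀ {t P} → stage t P ≡ true → InStage t P
    stage-view {t} {P} e with ∨-elim {onFirst t P} e
    ... | inj₁ h = let (j , j<t , P∈j) = anyBelow-elim t _ h in on-G j<t P∈j
    ... | inj₂ h with ∨-elim {anyBelow L _} h
    ...   | inj₂ h′ = apex (does-true⇒ (P Fin.≟ w) h′)
    ...   | inj₁ h′ with anyBelow-elim L _ h′
    ...     | j , j<L , h″ with anyBelow-elim (size j) _ h″
    ...       | k , k<size , h‴ = seeded j<L k<size (does-true⇒ (P Fin.≟ seedPoint j k) h‴)

    stage-intro : ∀ {t P} → InStage t P → stage t P ≡ true
    stage-intro (on-G j<t P∈j) = ∨-introˡ _ (anyBelow-intro _ _ j<t P∈j)
    stage-intro {t} {P} (seeded j<L k<size refl) =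
      ∨-introʳ (onFirst t P)
        (∨-introˡ _ (anyBelow-intro L _ j<L (anyBelow-intro _ _ k<size (dec-true (P Fin.≟ P) refl))))
    stage-intro {t} {P} (apex refl) =
      ∨-introʳ (onFirst t P) (∨-introʳ (anyBelow L _) (dec-true (P Fin.≟ P) refl))

    stage-mono : ∀ {t t′ P} → t ≤ t′ → stage t P ≡ true → stage t′ P ≡ true
    stage-mono {t} {t′} t≤t′ e with stage-view {t} e
    ... | on-G j<t P∈j         = stage-intro {t′} (on-G (<-≤-trans j<t t≤t′) P∈j)
    ... | seeded j<L k<size e′ = stage-intro {t′} (seeded j<L k<size e′)
    ... | apex e′              = stage-intro {t′} (apex e′)

    stage-on-family : ∀ {t P} → t ≤ L → stage t P ≡ true → P ≡ w ⊎ Σ ℕ λ j → j < L × P ∈ G j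
    stage-on-family {t} t≤L e with stage-view {t} e
    ... | on-G j<t P∈j            = inj₂ (_ , <-≤-trans j<t t≤L , P∈j)
    ... | seeded j<L k<size refl  = inj₂ (_ , j<L , seedPoint-∈ j<L k<size)
    ... | apex P≡w                = inj₁ P≡w

    -- G t carries its t crossings with earlier lines and its r - t seeds.
    G-rich : ∀ {t} → t < L → r ≤ ∣ G t ∩ stage t ∣
    G-rich {t} t<L = subst (_≤ ∣ G t ∩ stage t ∣) (m+[n∸m]≡n t≤r)
      (count-≥-disjoint-injections _ t (size t) (λ s → meet (G t) (G s)) (seedPoint t)
         crossing-∈ crossing-injective
         (λ k k<size → ∧-intro (seedPoint-∈ t<L k<size) (stage-intro {t} (seeded t<L k<size refl)))
         (λ k k′ → seedPoint-injective t<L)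
         disjoint)
      where
      t≤r : t ≤ r
      t≤r = ≤-trans (<⇒≤ t<L) (n≤1+n L)
      meet-∈′ : ∀ {s} → s < t → meet (G t) (G s) ∈ G t × meet (G t) (G s) ∈ G s
      meet-∈′ s<t = meet-∈ (G-injective t<L (<-trans s<t t<L) (λ t≡s → <⇒≢ s<t (sym t≡s)))
      crossing-∈ : ∀ s → s < t → inc (meet (G t) (G s)) (G t) ∧ stage t (meet (G t) (G s)) ≡ true
      crossing-∈ s s<t = ∧-intro (proj₁ (meet-∈′ s<t)) (stage-intro {t} (on-G s<t (proj₂ (meet-∈′ s<t))))
      crossing-injective : InjectiveBelow t (λ s → meet (G t) (G s))
      crossing-injective s s′ s<t s′<t e with s ≟ s′
      ... | yes s≡s′ = s≡s′
      ... | no  s≢s′ = ⊥-elim (true≢false (proj₁ (meet-∈′ s<t))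
              (third-line-avoids s<t s′<t t<L s≢s′ (proj₂ (meet-∈′ s<t))
                 (subst (_∈ G s′) (sym e) (proj₂ (meet-∈′ s′<t)))))
      disjoint : ∀ s k → s < t → k < size t → meet (G t) (G s) ≢ seedPoint t k
      disjoint s k s<t k<size e = true≢false (subst (_∈ G s) e (proj₂ (meet-∈′ s<t)))
        (seedPoint-∉ t<L k<size (<-trans s<t t<L) (<⇒≢ s<t))

    later-G-poor : ∀ {t i} → t < i → i < L → ∣ G i ∩ stage t ∣ ≤ L
    later-G-poor {t} {i} t<i i<L = count-≤-slots _ L R slot unique
      where
      R : Point → ℕ → Set
      R P s = (s < t × P ∈ G s) ⊎ Σ ℕ λ k → s ≡ t + k × P ≡ seedPoint i k
      t+size≤L : t + size i ≤ L
      t+size≤L = begin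
        t + (r ∸ i)     ≤⟨ +-monoʳ-≤ t (∸-monoʳ-≤ r t<i) ⟩
        t + (L ∸ t)     ≡⟨ m+[n∸m]≡n (<⇒≤ (<-trans t<i i<L)) ⟩
        L               ∎
        where open ≤-Reasoning
      slot : ∀ P → inc P (G i) ∧ stage t P ≡ true → Σ ℕ λ s → s < L × R P s
      slot P e with stage-view {t} (∧-conicalʳ _ _ e)
      ... | on-G s<t P∈s = _ , <-trans s<t (<-trans t<i i<L) , inj₁ (s<t , P∈s)
      ... | apex refl    = ⊥-elim (true≢false (∧-conicalˡ _ _ e) (w∉G i<L))
      ... | seeded {j} {k} j<L k<size refl with j ≟ i
      ...   | yes refl = t + k , <-≤-trans (+-monoʳ-< t k<size) t+size≤L , inj₂ (k , refl , refl)
      ...   | no j≢i   = ⊥-elim (true≢false (∧-conicalˡ _ _ e)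
                                   (seedPoint-∉ j<L k<size i<L (λ i≡j → j≢i (sym i≡j))))
      unique : ∀ P Q s → inc P (G i) ∧ stage t P ≡ true → inc Q (G i) ∧ stage t Q ≡ true →
               R P s → R Q s → P ≡ Q
      unique P Q s eP eQ (inj₁ (s<t , P∈s)) (inj₁ (_ , Q∈s)) =
        lines-meet-once (G-injective i<L s<L (λ i≡s → <⇒≢ (<-trans s<t t<i) (sym i≡s)))
          (∧-conicalˡ _ _ eP) P∈s (∧-conicalˡ _ _ eQ) Q∈s
        where
        s<L : s < L
        s<L = <-trans s<t (<-trans t<i i<L)
      unique P Q s eP eQ (inj₂ (k , refl , refl)) (inj₂ (k′ , t+k≡t+k′ , refl)) =
        cong (seedPoint i) (+-cancelˡ-≡ t k k′ t+k≡t+k′)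
      unique P Q s eP eQ (inj₁ (s<t , _)) (inj₂ (k , refl , _)) = ⊥-elim (m+n≮m t k s<t)
      unique P Q s eP eQ (inj₂ (k , refl , _)) (inj₁ (s<t , _)) = ⊥-elim (m+n≮m t k s<t)

    -- A line outside the family meets each G j at most once.
    poor-via-lines : ∀ {l} {B : PointSet q} → NotG l →
      (∀ {P} → P ∈ l → B P ≡ true → Σ ℕ λ j → j < L × P ∈ G j) → ∣ l ∩ B ∣ ≤ L
    poor-via-lines {l} notG on-line = count-≤-slots _ L (λ P j → j < L × P ∈ G j)
      (λ P e → let (j , j<L , P∈j) = on-line (∧-conicalˡ _ _ e) (∧-conicalʳ _ _ e) in j , j<L , j<L , P∈j)
      (λ P Q j eP eQ (j<L , P∈j) (_ , Q∈j) →
         lines-meet-once (notG j<L) (∧-conicalˡ _ _ eP) P∈j (∧-conicalˡ _ _ eQ) Q∈j)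

    -- If no point needs the line G j₀, the apex can take its slot.
    poor-via-lines-and-apex : ∀ {l j₀} {B : PointSet q} → NotG l → j₀ < L →
      (∀ {P} → P ∈ l → B P ≡ true → P ≡ w ⊎ Σ ℕ λ j → j < L × j ≢ j₀ × P ∈ G j) →
      ∣ l ∩ B ∣ ≤ L
    poor-via-lines-and-apex {l} {j₀} {B} notG j₀<L on-line = count-≤-slots _ L R slot unique
      where
      R : Point → ℕ → Set
      R P j = (j ≡ j₀ × P ≡ w) ⊎ (j < L × j ≢ j₀ × P ∈ G j)
      slot : ∀ P → inc P l ∧ B P ≡ true → Σ ℕ λ j → j < L × R P j
      slot P e with on-line (∧-conicalˡ _ _ e) (∧-conicalʳ _ _ e)
      ... | inj₁ P≡w                   = j₀ , j₀<L , inj₁ (refl , P≡w)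
      ... | inj₂ (j , j<L , j≢j₀ , P∈j) = j , j<L , inj₂ (j<L , j≢j₀ , P∈j)
      unique : ∀ P Q j → inc P l ∧ B P ≡ true → inc Q l ∧ B Q ≡ true → R P j → R Q j → P ≡ Q
      unique P Q j eP eQ (inj₁ (_ , P≡w)) (inj₁ (_ , Q≡w)) = trans P≡w (sym Q≡w)
      unique P Q j eP eQ (inj₂ (j<L , _ , P∈j)) (inj₂ (_ , _ , Q∈j)) =
        lines-meet-once (notG j<L) (∧-conicalˡ _ _ eP) P∈j (∧-conicalˡ _ _ eQ) Q∈j
      unique P Q j eP eQ (inj₁ (j≡j₀ , _)) (inj₂ (_ , j≢j₀ , _)) = contradiction j≡j₀ j≢j₀
      unique P Q j eP eQ (inj₂ (_ , j≢j₀ , _)) (inj₁ (j≡j₀ , _)) = contradiction j≡j₀ j≢j₀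

    off-apex-poor : ∀ {t l} → t ≤ L → NotG l → w ∉ l → ∣ l ∩ stage t ∣ ≤ L
    off-apex-poor {t} t≤L notG w∉l = poor-via-lines notG on-line
      where
      on-line : ∀ {P} → _ → stage t P ≡ true → _
      on-line P∈l e with stage-on-family t≤L e
      ... | inj₁ refl = ⊥-elim (true≢false P∈l w∉l)
      ... | inj₂ on-family = on-family

    -- The points of G i on l are just corner i, which is also on G 0.
    corner-poor : ∀ {t l i} → t ≤ L → NotG l → Side i → corner i ∈ l → ∣ l ∩ stage t ∣ ≤ L
    corner-poor {t} {l} {i} t≤L notG s corner∈l = poor-via-lines-and-apex notG (side-<L s) on-line
      where
      on-line : ∀ {P} → P ∈ l → stage t P ≡ true → P ≡ w ⊎ Σ ℕ λ j → j < L × j ≢ i × P ∈ G j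
      on-line {P} P∈l e with stage-on-family t≤L e
      ... | inj₁ P≡w = inj₁ P≡w
      ... | inj₂ (j , j<L , P∈j) with j ≟ i
      ...   | no j≢i   = inj₂ (j , j<L , j≢i , P∈j)
      ...   | yes refl = inj₂ (0 , s≤s z≤n , (λ 0≡i → <⇒≢ (side-pos s) 0≡i) ,
                               subst (_∈ G 0) (sym P≡corner) (proj₁ (corner-∈ s)))
        where
        P≡corner : P ≡ corner i
        P≡corner = lines-meet-once (notG j<L) P∈l P∈j corner∈l (proj₂ (corner-∈ s))

    -- For t < L the points of stage t on G last are the feet or lie on another G j.
    feet-poor : ∀ {t l} → t < L → NotG l → foot 1 ∉ l → foot 2 ∉ l → ∣ l ∩ stage t ∣ ≤ L
    feet-poor {t} {l} t<L notG foot₁∉l foot₂∉l = poor-via-lines-and-apex notG last<L on-line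
      where
      on-line : ∀ {P} → P ∈ l → stage t P ≡ true → P ≡ w ⊎ Σ ℕ λ j → j < L × j ≢ last × P ∈ G j
      on-line {P} P∈l e with stage-view {t} e
      ... | apex P≡w = inj₁ P≡w
      ... | on-G j<t P∈j = inj₂ (_ , <-trans j<t t<L , <⇒≢ (<-≤-trans j<t (≤-pred t<L)) , P∈j)
      ... | seeded {j} {k} j<L k<size refl with j ≟ last
      ...   | no j≢last = inj₂ (j , j<L , j≢last , seedPoint-∈ j<L k<size)
      ...   | yes refl  = ⊥-elim (true≢false (subst (_∈ l) seedPoint-last P∈l) (feet-∉ k))
        where
        feet-∉ : ∀ k → feet k ∉ l
        feet-∉ zero    = foot₁∉l
        feet-∉ (suc _) = foot₂∉l

    rich-line-is-G : ∀ {t l} → t < L → r ≤ ∣ l ∩ stage t ∣ → Σ ℕ λ j → j ≤ t × l ≡ G j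
    rich-line-is-G {t} {l} t<L rich with memberBelow L G l in isG
    ... | true with memberBelow-elim L G {l} isG
    ...   | i , i<L , refl with i ≤? t
    ...     | yes i≤t = i , i≤t , refl
    ...     | no  i≰t = ⊥-elim (≤⇒≯ (later-G-poor (≰⇒> i≰t) i<L) rich)
    rich-line-is-G {t} {l} t<L rich | false = ⊥-elim (≤⇒≯ poor rich)
      where
      notG : NotG l
      notG j<L l≡G =
        true≢false (subst (λ m → memberBelow L G m ≡ true) (sym l≡G) (memberBelow-intro L G j<L)) isG
      poor : ∣ l ∩ stage t ∣ ≤ L
      poor with inc w l in w∈?
      ... | false = off-apex-poor (<⇒≤ t<L) notG w∈?
      ... | true with inc (corner 1) l in c₁ | inc (corner 2) l in c₂
      ...   | true  | _     = corner-poor (<⇒≤ t<L) notG side₁ c₁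
      ...   | false | true  = corner-poor (<⇒≤ t<L) notG side₂ c₂
      ...   | false | false = feet-poor t<L notG (foot-∉l side₁ c₁) (foot-∉l side₂ c₂)
        where
        foot-∉l : ∀ {i} → Side i → corner i ∉ l → foot i ∉ l
        foot-∉l s c∉l = ≢true⇒false λ foot∈l → true≢false (corner-∈-through-foot s w∈? foot∈l) c∉l

    step-stage : ∀ {t} → t < L → ∀ P → step (stage t) P ≡ stage (suc t) P
    step-stage {t} t<L P = Bool-⇔⇒≡ forward backward
      where
      forward : step (stage t) P ≡ true → stage (suc t) P ≡ true
      forward e with step-elim {stage t} e
      ... | inj₁ old = stage-mono {t} (n≤1+n t) old
      ... | inj₂ (l , P∈l , rich) with rich-line-is-G t<L rich
      ...   | j , j≤t , refl = stage-intro {suc t} (on-G (s≤s j≤t) P∈l)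
      backward : stage (suc t) P ≡ true → step (stage t) P ≡ true
      backward e with stage-view {suc t} e
      ... | seeded j<L k<size e′ = step-extensive {stage t} (stage-intro {t} (seeded j<L k<size e′))
      ... | apex e′             = step-extensive {stage t} (stage-intro {t} (apex e′))
      ... | on-G j<1+t P∈j with m<1+n⇒m<n∨m≡n j<1+t
      ...   | inj₁ j<t  = step-extensive {stage t} (stage-intro {t} (on-G j<t P∈j))
      ...   | inj₂ refl = step-fires {stage t} P∈j (G-rich t<L)

    iter-stage : ∀ {t} → t ≤ L → ∀ P → iter t seed P ≡ stage t P
    iter-stage {zero}  _     P = refl
    iter-stage {suc t} t<L P = trans (step-cong (iter-stage (<⇒≤ t<L)) P) (step-stage t<L P)

    slow-point : Σ Point λ Z → Z ∈ spoke 1 × stage L Z ≡ false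
    slow-point = ∃-outside (λ P → inc P (spoke 1)) (stage L) (begin-strict
      ∣ spoke 1 ∩ stage L ∣          ≤⟨ corner-poor ≤-refl (∋w⇒NotG w∈spoke₁) side₁ (proj₂ (spoke-∋ side₁)) ⟩
      L                              <⟨ m<n⇒m<1+n L<q ⟩
      suc q                          ≡⟨ line-size (spoke 1) ⟨
      count (λ P → inc P (spoke 1)) ∎)
      where
      open ≤-Reasoning
      w∈spoke₁ : w ∈ spoke 1
      w∈spoke₁ = proj₁ (spoke-∋ side₁)

    slow-point-late : ∀ {Z} → Z ∈ spoke 1 → stage L Z ≡ false → iter r seed Z ≡ false
    slow-point-late {Z} Z∈spoke Z-slow = trans (step-cong (iter-stage ≤-refl) Z) (≢true⇒false missed)
      where
      Z∉G : ∀ {j} → j < L → Z ∉ G j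
      Z∉G j<L = ≢true⇒false λ Z∈j → true≢false (stage-intro {L} {Z} (on-G j<L Z∈j)) Z-slow
      Z≢w : Z ≢ w
      Z≢w Z≡w = true≢false (stage-intro {L} {Z} (apex Z≡w)) Z-slow
      poor : ∀ {m} → Z ∈ m → ∣ m ∩ stage L ∣ ≤ L
      poor {m} Z∈m with inc w m in w∈?
      ... | false = off-apex-poor ≤-refl notG w∈?
        where
        notG : NotG m
        notG j<L = ∈-∉⇒≢ˡ Z∈m (Z∉G j<L)
      ... | true  = corner-poor ≤-refl (∋w⇒NotG w∈?) side₁
                      (subst (corner 1 ∈_) (points-joined-once Z≢w Z∈spoke (proj₁ (spoke-∋ side₁)) Z∈m w∈?)
                             (proj₂ (spoke-∋ side₁)))
      missed : step (stage L) Z ≢ true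
      missed e with step-elim {stage L} e
      ... | inj₁ Z-in             = true≢false Z-in Z-slow
      ... | inj₂ (m , Z∈m , rich) = ≤⇒≯ (poor Z∈m) rich

    not-full-before-r+1 : TimeAtLeast seed (r + 1)
    not-full-before-r+1 k full with r <? k
    ... | yes r<k = subst (_≤ k) (+-comm 1 r) r<k
    ... | no  r≮k =
      ⊥-elim (true≢false (iter-mono seed (≮⇒≥ r≮k) (full Z)) (slow-point-late Z∈spoke Z-slow))
      where
      Z : Point
      Z = proj₁ slow-point
      Z∈spoke : Z ∈ spoke 1
      Z∈spoke = proj₁ (proj₂ slow-point)
      Z-slow : stage L Z ≡ false
      Z-slow = proj₂ (proj₂ slow-point)

    -- A good spoke carries w and L distinct crossings, so it fills up in round r.
    goodSpoke : Line → Bool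
    goodSpoke l = inc w l ∧ not (meets (crossing L G) l)

    L<count-goodSpoke : L < count goodSpoke
    L<count-goodSpoke = +-cancelˡ-< (count badSpoke) L _ (begin-strict
      count badSpoke + L                   ≤⟨ +-monoˡ-≤ L (≤-trans few-bad (count-crossing L G distinct)) ⟩
      L C 2 + L                            <⟨ s≤s LC2+L≤q ⟩
      suc q                                ≡⟨ point-degree w ⟨
      count (λ l → inc w l)                ≡⟨ count-split (λ l → inc w l) (meets (crossing L G)) ⟩
      count badSpoke + count goodSpoke     ∎)
      where
      open ≤-Reasoning
      badSpoke : Line → Bool
      badSpoke l = inc w l ∧ meets (crossing L G) l
      few-bad : count badSpoke ≤ count (crossing L G)
      few-bad = count-meeting-through-point (crossing L G) (off-lines⇒¬crossing G w∉G)

    goodSpoke-rich : ∀ {l} → goodSpoke l ≡ true → r ≤ ∣ l ∩ stage L ∣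
    goodSpoke-rich {l} good = subst (_≤ ∣ l ∩ stage L ∣) (+-comm L 1)
      (count-≥-disjoint-injections _ L 1 (λ s → meet l (G s)) (λ _ → w)
         (λ s s<L → ∧-intro (proj₁ (meet-∈′ s<L)) (stage-intro {L} (on-G s<L (proj₂ (meet-∈′ s<L)))))
         crossing-free
         (λ _ _ → ∧-intro w∈l (stage-intro {L} (apex refl)))
         w-once
         (λ s _ s<L _ e → true≢false (subst (_∈ G s) e (proj₂ (meet-∈′ s<L))) (w∉G s<L)))
      where
      w∈l : w ∈ l
      w∈l = ∧-conicalˡ _ _ good
      w-once : InjectiveBelow 1 (λ _ → w)
      w-once zero    zero    _        _        _ = refl
      w-once (suc _) _       (s≤s ()) _        _
      w-once _       (suc _) _        (s≤s ()) _
      meet-∈′ : ∀ {s} → s < L → meet l (G s) ∈ l × meet l (G s) ∈ G s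
      meet-∈′ s<L = meet-∈ (∋w⇒NotG w∈l s<L)
      crossing-free : InjectiveBelow L (λ s → meet l (G s))
      crossing-free s s′ s<L s′<L e with s ≟ s′
      ... | yes s≡s′ = s≡s′
      ... | no  s≢s′ = ⊥-elim (true≢false
              (meets-intro (crossing L G) (crossing-intro-≢ G s<L s′<L s≢s′ (proj₂ (meet-∈′ s<L))
                                             (subst (_∈ G s′) (sym e) (proj₂ (meet-∈′ s′<L))))
                                          (proj₁ (meet-∈′ s<L)))
              (not-true⇒false (∧-conicalʳ _ _ good)))

    goodSpoke-covered : ∀ {l Q} → goodSpoke l ≡ true → Q ∈ l → iter r seed Q ≡ true
    goodSpoke-covered {l} {Q} good Q∈l =
      trans (step-cong (iter-stage ≤-refl) Q) (step-fires {stage L} Q∈l (goodSpoke-rich good))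

    -- A line m through P missing w meets the more than L good spokes in distinct filled points.
    full-after-r+1 : IsFull (iter (suc r) seed)
    full-after-r+1 P with P Fin.≟ w
    ... | yes refl = step-extensive {iter r seed}
                       (iter-mono seed (n≤1+n L) (trans (iter-stage ≤-refl w) (stage-intro {L} (apex refl))))
    ... | no  P≢w with ∃-outside (λ m → inc P m) (λ m → inc w m) one-line
      where
      one-line : count (λ m → inc P m ∧ inc w m) < count (λ m → inc P m)
      one-line = subst₂ _<_ (sym (points-joined P w P≢w)) (sym (point-degree P))
                   (s≤s (≤-trans (s≤s z≤n) L<q))
    ...   | m , P∈m , w∉m = step-fires {iter r seed} P∈m
            (≤-trans L<count-goodSpoke (count-≤-injection goodSpoke _ (λ l Q → Q ≡ meet l m) image unique))
      where
      meet-∈′ : ∀ {l} → goodSpoke l ≡ true → meet l m ∈ l × meet l m ∈ m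
      meet-∈′ good = meet-∈ (∈-∉⇒≢ˡ (∧-conicalˡ _ _ good) w∉m)
      image : ∀ l → goodSpoke l ≡ true → Σ Point λ Q → (inc Q m ∧ iter r seed Q) ≡ true × Q ≡ meet l m
      image l good =
        meet l m , ∧-intro (proj₂ (meet-∈′ good)) (goodSpoke-covered good (proj₁ (meet-∈′ good))) , refl
      unique : ∀ l l′ Q → goodSpoke l ≡ true → goodSpoke l′ ≡ true →
               Q ≡ meet l m → Q ≡ meet l′ m → l ≡ l′
      unique l l′ Q good good′ refl Q≡ =
        points-joined-once (∈-∉⇒≢ (proj₂ (meet-∈′ good)) w∉m ∘ sym)
          (∧-conicalˡ _ _ good) (proj₁ (meet-∈′ good))
          (∧-conicalˡ _ _ good′) (subst (_∈ l′) (sym Q≡) (proj₁ (meet-∈′ good′)))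

  slow-percolating-set : Σ (PointSet q) λ A → Percolates A × TimeAtLeast A (r + 1)
  slow-percolating-set = seed , (suc r , full-after-r+1) , not-full-before-r+1
    where
    w-exists : Σ Point λ w → ∀ l → apexBad l ≡ true → w ∉ l
    w-exists = point-off-lines apexBad count-apexBad
    open WithApex (proj₁ w-exists) (proj₂ w-exists)

proposition15 : (q : ℕ) → 2 ≤ q → (Π : ProjectivePlane q) → (r : ℕ) → 5 ≤ r → r C 2 ≤ q →
                  Σ (PointSet q) (λ A → Percolation.Percolates Π r A × Percolation.TimeAtLeast Π r A (r + 1))
proposition15 q _ Π (suc (suc last)) (s≤s (s≤s 3≤last)) rC2≤q =
  Construction.slow-percolating-set Π last 3≤last rC2≤q G distinct noThree
  where
  open Σ (Plane.general-position Π (suc last) (≤-trans (nC2≤[1+n]C2 (suc last)) rC2≤q))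
    renaming (proj₁ to G; proj₂ to G-general)
  open Σ G-general renaming (proj₁ to distinct; proj₂ to noThree)
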